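{- Identify the twelve pitch classes of the chromatic scale with $\mathbb{Z}/12$ (semitones, $C=0$). For $r\in\mathbb{Z}/12$ the major triad with root $r$ is $\{r,r+4,r+7\}$ and the minor triad with root $r$ is $\{r,r+3,r+7\}$. Consider the incidence structure whose points are the $12$ major triads and whose lines are the $12$ pitch classes, with a pitch class incident with a major triad iff it belongs to it. Then this incidence structure is a configuration $\{12_3\}$ of Daublebsky von Sterneck type $\mathrm{D}222$. Likewise, the incidence structure of the $12$ minor triads and the $12$ pitch classes, with incidence given by membership, is a configuration $\{12_3\}$ of Daublebsky von Sterneck type $\mathrm{D}222$.
   Context: A configuration $\{12_3\}$ is an incidence structure of $12$ points and $12$ lines in which each point lies on exactly $3$ lines, each line contains exactly $3$ points, and two distinct points lie on at most one common line. Daublebsky von Sterneck (1895) classified the $\{12_3\}$ configurations up to isomorphism, labelling them D1, D2, ...; the type $\mathrm{D}222$ is one of these classes. A model of $\mathrm{D}222$ (the Eulerian tonnetz, as identified in earlier work of the authors) has points the $12$ major triads and lines the $12$ minor triads, a major triad incident with a minor triad iff they share exactly two pitch classes; equivalently, points $x\in\mathbb{Z}/12$, lines $y\in\mathbb{Z}/12$, with $x$ incident to $y$ iff $y-x\in\{0,4,9\}$. Two incidence structures are of the same type iff they are isomorphic (via bijections on points and on lines preserving incidence, possibly after interchanging points and lines). -}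

module Defs where

open import Level using (0ℓ)
open import Data.Nat using (ℕ; _+_)
open import Data.Nat.DivMod using (_mod_)
open import Data.Fin using (Fin; toℕ)
open import Data.List using (List; []; _∷_; length; filter; allFin)
open import Data.List.Membership.Propositional using (_∈_)
open import Data.List.Membership.DecPropositional (Data.Fin._≟_ {12}) using (_∈?_)
open import Relation.Nullary using (Dec; ¬_)
open import Relation.Binary.PropositionalEquality using (_≡_)
open import Function.Bundles using (_↔_; _⇔_; Inverse)

PC : Set
PC = Fin 12

_⊕_ : PC → ℕ → PC
r ⊕ k = (toℕ r + k) mod 12

majorTriad : PC → List PC
majorTriad r = r ∷ (r ⊕ 4) ∷ (r ⊕ 7) ∷ []

minorTriad : PC → List PC
minorTriad r = r ∷ (r ⊕ 3) ∷ (r ⊕ 7) ∷ []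

record IncStr : Set₁ where
  field
    Inc  : Fin 12 → Fin 12 → Set
    dec  : ∀ x y → Dec (Inc x y)
open IncStr public

linesThrough : IncStr → Fin 12 → ℕ
linesThrough S x = length (filter (λ y → dec S x y) (allFin 12))

pointsOn : IncStr → Fin 12 → ℕ
pointsOn S y = length (filter (λ x → dec S x y) (allFin 12))

record IsConfig12₃ (S : IncStr) : Set where
  field
    pointDeg : ∀ x → linesThrough S x ≡ 3
    lineDeg  : ∀ y → pointsOn S y ≡ 3
    atMostOneLine : ∀ x x' → ¬ (x ≡ x') → ∀ y y' →
      Inc S x y → Inc S x' y → Inc S x y' → Inc S x' y' → y ≡ y'

dual : IncStr → IncStr
dual S = record { Inc = λ x y → Inc S y x ; dec = λ x y → dec S y x }

Iso : IncStr → IncStr → Set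
Iso S T = Σ (Fin 12 ↔ Fin 12) λ f → Σ (Fin 12 ↔ Fin 12) λ g →
  ∀ x y → Inc S x y ⇔ Inc T (Inverse.to f x) (Inverse.to g y)
  where open import Data.Product using (Σ)

-- Model of D222 (Eulerian tonnetz): x incident to y iff y - x ∈ {0,4,9}
D222model : IncStr
D222model = record { Inc = λ x y → y ∈ (x ∷ (x ⊕ 4) ∷ (x ⊕ 9) ∷ [])
                   ; dec = λ x y → y ∈? (x ∷ (x ⊕ 4) ∷ (x ⊕ 9) ∷ []) }

open import Data.Sum using (_⊎_)
IsTypeD222 : IncStr → Set
IsTypeD222 S = Iso S D222model ⊎ Iso (dual S) D222model

majorStr : IncStr
majorStr = record { Inc = λ r p → p ∈ majorTriad r ; dec = λ r p → p ∈? majorTriad r }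

minorStr : IncStr
minorStr = record { Inc = λ r p → p ∈ minorTriad r ; dec = λ r p → p ∈? minorTriad r }

{-# OPTIONS --safe #-}
-- Both structures are isomorphic to the Eulerian tonnetz, without dualising.
-- Negating pitch classes turns the major triad {r, r+4, r+7} into
-- {8-r, 8-r+4, 8-r+9}, the tonnetz line set of 8-r; the minor triad
-- {r, r+3, r+7} is already the tonnetz line set of r+3.  The rest (the
-- configuration axioms, invertibility of the maps) is a finite check.
module Submission where

open import Defs
open import Data.Product using (_×_; _,_; uncurry)
open import Data.Sum using (inj₁)
open import Data.Nat using (_∸_)
import Data.Nat as ℕ
open import Data.Nat.DivMod using (_mod_)
open import Data.Fin using (Fin; toℕ; _≟_)
open import Data.Fin.Properties using (all?)
open import Relation.Nullary using (Dec; ¬_; ¬?)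
open import Relation.Nullary.Decidable using (True; toWitness; map′; from-yes; _×-dec_; _→-dec_)
open import Relation.Binary.PropositionalEquality using (_≡_)
open import Function.Bundles using (_↔_; _⇔_; mk⇔; mk↔ₛ′; Inverse; Equivalence)
open import Function.Construct.Identity using (↔-id)

_⇔-dec_ : {A B : Set} → Dec A → Dec B → Dec (A ⇔ B)
a? ⇔-dec b? = map′ (uncurry mk⇔) (λ e → Equivalence.to e , Equivalence.from e)
                   ((a? →-dec b?) ×-dec (b? →-dec a?))

module _ (S : IncStr) where

  atMostOneLine? : Dec (∀ x x' → ¬ (x ≡ x') → ∀ y y' →
                        Inc S x y → Inc S x' y → Inc S x y' → Inc S x' y' → y ≡ y')
  atMostOneLine? =
    all? λ x → all? λ x' → ¬? (x ≟ x') →-dec all? λ y → all? λ y' →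
      dec S x y →-dec dec S x' y →-dec dec S x y' →-dec dec S x' y' →-dec y ≟ y'

  isConfig12₃? : Dec (IsConfig12₃ S)
  isConfig12₃? =
    map′ (λ (p , l , a) → record { pointDeg = p ; lineDeg = l ; atMostOneLine = a })
         (λ c → IsConfig12₃.pointDeg c , IsConfig12₃.lineDeg c , IsConfig12₃.atMostOneLine c)
         ((all? λ x → linesThrough S x ℕ.≟ 3) ×-dec (all? λ y → pointsOn S y ℕ.≟ 3) ×-dec atMostOneLine?)

preservesIncidence? : (S T : IncStr) (f g : Fin 12 ↔ Fin 12) →
                      Dec (∀ x y → Inc S x y ⇔ Inc T (Inverse.to f x) (Inverse.to g y))
preservesIncidence? S T f g =
  all? λ x → all? λ y → dec S x y ⇔-dec dec T (Inverse.to f x) (Inverse.to g y)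

cancels? : ∀ {n} (f g : Fin n → Fin n) → Dec (∀ x → f (g x) ≡ x)
cancels? f g = all? λ x → f (g x) ≟ x

permutation : ∀ {n} (f g : Fin n → Fin n) →
              {True (cancels? f g)} → {True (cancels? g f)} → Fin n ↔ Fin n
permutation f g {fg} {gf} = mk↔ₛ′ f g (toWitness fg) (toWitness gf)

negate : PC → PC
negate p = (12 ∸ toℕ p) mod 12

reflect8 : PC → PC
reflect8 r = negate r ⊕ 8

majorStr≅D222model : Iso majorStr D222model
majorStr≅D222model =
  reflection8 , negation , from-yes (preservesIncidence? majorStr D222model reflection8 negation)
  where
  reflection8 negation : PC ↔ PC
  reflection8 = permutation reflect8 reflect8
  negation    = permutation negate negate

minorStr≅D222model : Iso minorStr D222model
minorStr≅D222model =
  shift3 , ↔-id PC , from-yes (preservesIncidence? minorStr D222model shift3 (↔-id PC))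
  where
  shift3 : PC ↔ PC
  shift3 = permutation (_⊕ 3) (_⊕ 9)

proposition6 : (IsConfig12₃ majorStr × IsTypeD222 majorStr) × (IsConfig12₃ minorStr × IsTypeD222 minorStr)
proposition6 = (from-yes (isConfig12₃? majorStr) , inj₁ majorStr≅D222model)
             , (from-yes (isConfig12₃? minorStr) , inj₁ minorStr≅D222model)
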